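{- For every integer $k\ge 1$, the $k$-triangle $T_k$ satisfies $q(T_k)=\frac{\lfloor k/2\rfloor+1}{k+2}$.
   Context: All graphs are finite, simple and undirected. For a vertex $v$, $d(v)$ is its degree, $N[v]$ its closed neighbourhood and $d[v]=d(v)+1$. A partition of $G$ is a pair $(V_1,V_2)$ of nonempty disjoint sets with union $V(G)$; for $v\in V_i$, $q^i(v)=|N[v]\cap V_i|/d[v]$, and $q(G)=\max_{(V_1,V_2)}\min\{q^i(v): i\in\{1,2\}, v\in V_i\}$ over all partitions. The $k$-triangle $T_k$ has vertex set $\{s,t,v_1,\dots,v_k\}$ and edge set $\{st\}\cup\{v_is,v_it:1\le i\le k\}$. -}

module Defs where

open import Data.Bool using (Bool; true; false; _∧_; _∨_; not; if_then_else_)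
open import Data.Nat using (ℕ; zero; suc; _+_)
open import Data.Fin using (Fin; zero; suc; _≟_)
open import Data.List using (List; []; _∷_; map; _++_; length; filterᵇ; allFin; foldr)
open import Data.Bool.ListAction using (any)
open import Data.Integer using (+_)
open import Data.Rational using (ℚ; _/_; _⊔_; _⊓_; 0ℚ; 1ℚ)
open import Relation.Nullary using (does)
open import Relation.Binary.PropositionalEquality using (_≡_)

record Graph : Set where
  field
    n     : ℕ
    adj   : Fin n → Fin n → Bool
    sym   : ∀ u v → adj u v ≡ adj v u
    irrefl : ∀ v → adj v v ≡ false
open Graph public

countᶠ : ∀ {n} → (Fin n → Bool) → ℕ
countᶠ {n} p = length (filterᵇ p (allFin n))

deg : (G : Graph) → Fin (n G) → ℕ
deg G v = countᶠ (adj G v)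

inN[_] : (G : Graph) → Fin (n G) → Fin (n G) → Bool
inN[ G ] v u = does (u ≟ v) ∨ adj G v u

-- a bipartition of the vertex set, encoded by its side function
-- (vertices mapped to true form V₁, those mapped to false form V₂)
Side : ℕ → Set
Side n = Fin n → Bool

allSides : ∀ n → List (Side n)
allSides zero    = (λ ()) ∷ []
allSides (suc n) = map (λ f → λ { zero → true ; (suc i) → f i }) (allSides n)
                ++ map (λ f → λ { zero → false ; (suc i) → f i }) (allSides n)

isPartition : ∀ {n} → Side n → Bool
isPartition {n} f = any f (allFin n) ∧ any (λ v → not (f v)) (allFin n)

_==ᵇ_ : Bool → Bool → Bool
true  ==ᵇ b = b
false ==ᵇ b = not b

qv : (G : Graph) → Side (n G) → Fin (n G) → ℚ
qv G f v = (+ countᶠ (λ u → inN[ G ] v u ∧ (f u ==ᵇ f v))) / suc (deg G v)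

-- min over all vertices of q^i(v); every such value lies in [0,1],
-- so starting the fold at 1 is harmless for graphs with ≥ 1 vertex.
minQ : (G : Graph) → Side (n G) → ℚ
minQ G f = foldr (λ v r → qv G f v ⊓ r) 1ℚ (allFin (n G))

-- q(G): max over all partitions (V₁,V₂) with both parts nonempty.
-- All values are ≥ 0, so starting the fold at 0 is harmless whenever
-- a partition exists (i.e. G has ≥ 2 vertices).
q : Graph → ℚ
q G = foldr (λ f r → if isPartition f then minQ G f ⊔ r else r) 0ℚ (allSides (n G))

-- The k-triangle T_k on Fin (k + 2): vertex 0 is s, vertex 1 is t,
-- vertex (i+2) is v_{i+1}. Edges: st, and v_i s, v_i t for all i.
Tadj : ∀ k → Fin (suc (suc k)) → Fin (suc (suc k)) → Bool
Tadj k zero zero = false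
Tadj k zero (suc _) = true
Tadj k (suc zero) zero = true
Tadj k (suc zero) (suc zero) = false
Tadj k (suc zero) (suc (suc _)) = true
Tadj k (suc (suc _)) zero = true
Tadj k (suc (suc _)) (suc zero) = true
Tadj k (suc (suc _)) (suc (suc _)) = false

Tsym : ∀ k u v → Tadj k u v ≡ Tadj k v u
Tsym k zero zero = _≡_.refl
Tsym k zero (suc zero) = _≡_.refl
Tsym k zero (suc (suc _)) = _≡_.refl
Tsym k (suc zero) zero = _≡_.refl
Tsym k (suc zero) (suc zero) = _≡_.refl
Tsym k (suc zero) (suc (suc _)) = _≡_.refl
Tsym k (suc (suc _)) zero = _≡_.refl
Tsym k (suc (suc _)) (suc zero) = _≡_.refl
Tsym k (suc (suc _)) (suc (suc _)) = _≡_.refl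

Tirr : ∀ k v → Tadj k v v ≡ false
Tirr k zero = _≡_.refl
Tirr k (suc zero) = _≡_.refl
Tirr k (suc (suc _)) = _≡_.refl

T : ℕ → Graph
T k = record { n = suc (suc k) ; adj = Tadj k ; sym = Tsym k ; irrefl = Tirr k }

-- Write h = ⌊k/2⌋. If s and t lie on different sides, their quotients are
-- (1 + a)/(k+2) and (1 + b)/(k+2), where a and b count the v_i on the side of
-- s and of t; as a + b = k, the smaller of a, b is at most h. If s and t lie
-- on the same side, some v_i lies on the other one, and its quotient is 1/3,
-- which is at most (h + 1)/(k + 2). Conversely, putting s together with h of
-- the v_i and t with the remaining k - h gives quotients (1 + h)/(k+2) at s,
-- (1 + k - h)/(k+2) at t and 2/3 at every v_i, all at least (h + 1)/(k + 2).
module Submission where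

open import Defs
open import Data.Nat using (ℕ; suc; _+_; _≤_; _/_)
open import Data.Integer using (+_)
open import Data.Rational using (ℚ) renaming (_/_ to _/ℚ_)
open import Relation.Binary.PropositionalEquality using (_≡_)

open import Data.Bool using (Bool; true; false; _∧_; not; if_then_else_)
open import Data.Bool.ListAction using (or)
open import Data.Bool.Properties using (not-¬; ¬-not; ∨-identityʳ; T-≡; T-not-≡; T-∧)
import Data.Bool.Properties as Bool
open import Data.Empty using (⊥-elim)
open import Data.Fin using (Fin; zero; toℕ; _≟_)
import Data.Fin as Fin
open import Data.Integer.Properties using (pos-*)
import Data.Integer as ℤ
open import Data.List using (List; []; _∷_; foldr; length; filterᵇ; allFin; tabulate)
open import Data.List.Membership.Propositional using (_∈_)
open import Data.List.Membership.Propositional.Properties using (∈-allFin)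
open import Data.List.Properties using (foldr-cong; map-cong)
open import Data.List.Relation.Unary.Any using (Any; here; there; satisfied)
import Data.List.Relation.Unary.Any as Any
open import Data.List.Relation.Unary.Any.Properties using (map⁺; ++⁺ˡ; ++⁺ʳ; any⁻)
open import Data.Nat using (zero; _*_; _<_; _<ᵇ_; z≤n; s≤s)
open import Data.Nat.DivMod using (m≡m%n+[m/n]*n; m%n<n; m/n*n≤m; m/n≤m; m*n/n≡m; /-monoˡ-≤)
open import Data.Nat.Properties
  using (≤-total; +-comm; +-suc; *-suc; *-identityʳ; *-identityˡ;
         +-mono-≤; +-monoˡ-<; +-monoʳ-≤; +-cancelˡ-≤; *-monoˡ-≤; n≤1+n; module ≤-Reasoning)
open import Data.Nat.Tactic.RingSolver using (solve-∀)
open import Data.Product using (∃; _×_; _,_)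
import Data.Rational as ℚ
open import Data.Rational.Properties using (toℚᵘ-cancel-≤; toℚᵘ-fromℚᵘ; ⊓-glb; ⊔-lub; p⊓q≤p; p⊓q≤q; p≤p⊔q; p≤q⊔p)
import Data.Rational.Properties as ℚ
import Data.Rational.Unnormalised as ℚᵘ
open import Data.Rational.Unnormalised.Properties using (≤-respˡ-≃; ≤-respʳ-≃; ≃-sym)
open import Data.Sum using ([_,_]′)
open import Function using (_∘_; _$_)
open import Function.Bundles using (Equivalence)
open import Relation.Nullary using (does)
open import Relation.Nullary.Decidable using (toSum)
open import Relation.Binary.PropositionalEquality using (_≗_; refl; trans; cong; cong₂; subst; subst₂)
import Relation.Binary.PropositionalEquality as ≡

open Equivalence using (to; from)

*2≡+ : ∀ m → m * 2 ≡ m + m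
*2≡+ m = trans (*-suc m 1) (cong (_+_ m) (*-identityʳ m))

half*2≤ : ∀ n → n / 2 * 2 ≤ n
half*2≤ n = m/n*n≤m n 2

<[1+half]*2 : ∀ n → n < suc (n / 2) * 2
<[1+half]*2 n = subst (_< suc (n / 2) * 2) (≡.sym (m≡m%n+[m/n]*n n 2)) (+-monoˡ-< (n / 2 * 2) (m%n<n n 2))

≤-half : ∀ {a b n} → a + b ≡ n → a ≤ b → a ≤ n / 2
≤-half {a} {b} {n} a+b≡n a≤b = begin
  a         ≡⟨ ≡.sym (m*n/n≡m a 2) ⟩
  a * 2 / 2 ≤⟨ /-monoˡ-≤ 2 (subst (a * 2 ≤_) a+b≡n a*2≤a+b) ⟩
  n / 2     ∎
  where
  open ≤-Reasoning
  a*2≤a+b : a * 2 ≤ a + b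
  a*2≤a+b = subst (_≤ a + b) (≡.sym (*2≡+ a)) (+-monoʳ-≤ a a≤b)

half-≤ : ∀ {b n} → n / 2 + b ≡ n → n / 2 ≤ b
half-≤ {b} {n} h+b≡n = +-cancelˡ-≤ (n / 2) (n / 2) b $
  subst₂ _≤_ (*2≡+ (n / 2)) (≡.sym h+b≡n) (half*2≤ n)

2+n≤[1+half]*3 : ∀ n → 2 + n ≤ suc (n / 2) * 3
2+n≤[1+half]*3 n = begin
  1 + suc n                     ≤⟨ +-mono-≤ (s≤s z≤n) (<[1+half]*2 n) ⟩
  suc (n / 2) + suc (n / 2) * 2 ≡⟨ ≡.sym (*-suc (suc (n / 2)) 2) ⟩
  suc (n / 2) * 3               ∎
  where open ≤-Reasoning

[1+half]*3≤2*[2+n] : ∀ n → suc (n / 2) * 3 ≤ 2 * (2 + n)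
[1+half]*3≤2*[2+n] n = begin
  suc h * 3         ≡⟨ expand h ⟩
  3 + (h + h * 2)   ≤⟨ +-monoʳ-≤ 3 (+-mono-≤ (m/n≤m n 2) (half*2≤ n)) ⟩
  3 + (n + n)       ≤⟨ n≤1+n _ ⟩
  4 + (n + n)       ≡⟨ collect n ⟩
  2 * (2 + n)       ∎
  where
  open ≤-Reasoning
  h : ℕ
  h = n / 2
  expand : ∀ x → suc x * 3 ≡ 3 + (x + x * 2)
  expand = solve-∀
  collect : ∀ x → 4 + (x + x) ≡ 2 * (2 + x)
  collect = solve-∀

-- + a /ℚ suc c is by definition fromℚᵘ (mkℚᵘ (+ a) c), so the comparison is
-- cross-multiplication in ℚᵘ.
fraction-≤ : ∀ a b c d → a * suc d ≤ b * suc c → + a /ℚ suc c ℚ.≤ + b /ℚ suc d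
fraction-≤ a b c d ad≤bc = toℚᵘ-cancel-≤ $
  ≤-respˡ-≃ (≃-sym (toℚᵘ-fromℚᵘ (ℚᵘ.mkℚᵘ (+ a) c))) $
  ≤-respʳ-≃ (≃-sym (toℚᵘ-fromℚᵘ (ℚᵘ.mkℚᵘ (+ b) d))) $
  ℚᵘ.*≤* (subst₂ ℤ._≤_ (pos-* a (suc d)) (pos-* b (suc c)) (ℤ.+≤+ ad≤bc))

fraction-mono : ∀ {a b} c → a ≤ b → + a /ℚ suc c ℚ.≤ + b /ℚ suc c
fraction-mono {a} {b} c a≤b = fraction-≤ a b c c (*-monoˡ-≤ (suc c) a≤b)

bit : Bool → ℕ
bit false = 0
bit true  = 1

count : ∀ {n} → (Fin n → Bool) → ℕ
count {zero}  p = 0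
count {suc n} p = bit (p zero) + count (p ∘ Fin.suc)

length-filterᵇ-tabulate : ∀ {A : Set} n (p : A → Bool) (g : Fin n → A) →
                          length (filterᵇ p (tabulate g)) ≡ count (p ∘ g)
length-filterᵇ-tabulate zero    p g = refl
length-filterᵇ-tabulate (suc n) p g with p (g zero)
... | true  = cong suc (length-filterᵇ-tabulate n p (g ∘ Fin.suc))
... | false = length-filterᵇ-tabulate n p (g ∘ Fin.suc)

countᶠ≡count : ∀ {n} (p : Fin n → Bool) → countᶠ p ≡ count p
countᶠ≡count {n} p = length-filterᵇ-tabulate n p (λ i → i)

count-cong : ∀ {n} {p q : Fin n → Bool} → p ≗ q → count p ≡ count q
count-cong {zero}  p≗q = refl
count-cong {suc n} p≗q = cong₂ _+_ (cong bit (p≗q zero)) (count-cong (p≗q ∘ Fin.suc))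

countᶠ-cong : ∀ {n} {p q : Fin n → Bool} → p ≗ q → countᶠ p ≡ countᶠ q
countᶠ-cong {p = p} {q} p≗q = trans (countᶠ≡count p) (trans (count-cong p≗q) (≡.sym (countᶠ≡count q)))

count-false : ∀ n → count {n} (λ _ → false) ≡ 0
count-false zero    = refl
count-false (suc n) = count-false n

count-true : ∀ n → count {n} (λ _ → true) ≡ n
count-true zero    = refl
count-true (suc n) = cong suc (count-true n)

count-+-count-not : ∀ {n} (p : Fin n → Bool) → count p + count (not ∘ p) ≡ n
count-+-count-not {zero}  p = refl
count-+-count-not {suc n} p with p zero
... | true  = cong suc (count-+-count-not (p ∘ Fin.suc))
... | false = trans (+-suc _ _) (cong suc (count-+-count-not (p ∘ Fin.suc)))

count-≟ : ∀ {n} (i : Fin n) (p : Fin n → Bool) → p i ≡ true → count (λ j → does (j ≟ i) ∧ p j) ≡ 1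
count-≟ {suc n} zero       p pi≡true rewrite pi≡true = cong suc (count-false n)
count-≟ {suc n} (Fin.suc i) p pi≡true = count-≟ i (p ∘ Fin.suc) pi≡true

count-<ᵇ : ∀ {n h} → h ≤ n → count {n} (λ i → toℕ i <ᵇ h) ≡ h
count-<ᵇ {zero}  z≤n     = refl
count-<ᵇ {suc n} {zero} _ = count-false (suc n)
count-<ᵇ {suc n} {suc h} (s≤s h≤n) = cong suc (count-<ᵇ h≤n)

==ᵇ-refl : ∀ b → (b ==ᵇ b) ≡ true
==ᵇ-refl true  = refl
==ᵇ-refl false = refl

==ᵇ-not : ∀ b c → (b ==ᵇ not c) ≡ not (b ==ᵇ c)
==ᵇ-not true  c = refl
==ᵇ-not false c = refl

==ᵇ-not-self : ∀ b → (b ==ᵇ not b) ≡ false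
==ᵇ-not-self b = trans (==ᵇ-not b b) (cong not (==ᵇ-refl b))

not-self-==ᵇ : ∀ b → (not b ==ᵇ b) ≡ false
not-self-==ᵇ true  = refl
not-self-==ᵇ false = refl

bit-true==ᵇ+bit-false==ᵇ : ∀ c → bit (true ==ᵇ c) + (bit (false ==ᵇ c) + 1) ≡ 2
bit-true==ᵇ+bit-false==ᵇ true  = refl
bit-true==ᵇ+bit-false==ᵇ false = refl

==ᵇ-true : ∀ b → (b ==ᵇ true) ≡ b
==ᵇ-true true  = refl
==ᵇ-true false = refl

allSides-complete : ∀ n (f : Side n) → Any (_≗ f) (allSides n)
allSides-complete zero    f = here (λ ())
allSides-complete (suc n) f with f zero in f0
... | true  = ++⁺ˡ (map⁺ (Any.map (λ g≗f → λ { zero → ≡.sym f0 ; (Fin.suc i) → g≗f i })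
                                  (allSides-complete n (f ∘ Fin.suc))))
... | false = ++⁺ʳ _ (map⁺ (Any.map (λ g≗f → λ { zero → ≡.sym f0 ; (Fin.suc i) → g≗f i })
                                    (allSides-complete n (f ∘ Fin.suc))))

isPartition-cong : ∀ {n} {f g : Side n} → f ≗ g → isPartition f ≡ isPartition g
isPartition-cong {n} f≗g =
  cong₂ _∧_ (cong or (map-cong f≗g (allFin n))) (cong or (map-cong (cong not ∘ f≗g) (allFin n)))

qv-cong : ∀ (G : Graph) {f g : Side (n G)} → f ≗ g → qv G f ≗ qv G g
qv-cong G f≗g x = cong (λ c → + c /ℚ suc (deg G x))
  (countᶠ-cong (λ u → cong (inN[ G ] x u ∧_) (cong₂ _==ᵇ_ (f≗g u) (f≗g x))))

minQ-cong : ∀ (G : Graph) {f g : Side (n G)} → f ≗ g → minQ G f ≡ minQ G g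
minQ-cong G f≗g = foldr-cong (λ x r → cong (ℚ._⊓ r) (qv-cong G f≗g x)) refl (allFin (n G))

module _ {A : Set} (value : A → ℚ) where

  minOver : List A → ℚ
  minOver = foldr (λ a r → value a ℚ.⊓ r) ℚ.1ℚ

  minOver≤ : ∀ {a} xs → a ∈ xs → minOver xs ℚ.≤ value a
  minOver≤ (a ∷ xs) (here refl)  = p⊓q≤p (value a) (minOver xs)
  minOver≤ (b ∷ xs) (there a∈xs) = ℚ.≤-trans (p⊓q≤q (value b) (minOver xs)) (minOver≤ xs a∈xs)

  ≤-minOver : ∀ {r} xs → r ℚ.≤ ℚ.1ℚ → (∀ a → r ℚ.≤ value a) → r ℚ.≤ minOver xs
  ≤-minOver []       r≤1 r≤value = r≤1
  ≤-minOver (a ∷ xs) r≤1 r≤value = ⊓-glb (r≤value a) (≤-minOver xs r≤1 r≤value)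

  module _ (include : A → Bool) where

    maxOver : List A → ℚ
    maxOver = foldr (λ a r → if include a then value a ℚ.⊔ r else r) ℚ.0ℚ

    maxOver≤ : ∀ {r} xs → ℚ.0ℚ ℚ.≤ r → (∀ a → include a ≡ true → value a ℚ.≤ r) → maxOver xs ℚ.≤ r
    maxOver≤ []       0≤r value≤r = 0≤r
    maxOver≤ (a ∷ xs) 0≤r value≤r with include a in included
    ... | true  = ⊔-lub (value≤r a included) (maxOver≤ xs 0≤r value≤r)
    ... | false = maxOver≤ xs 0≤r value≤r

    ≤-maxOver : ∀ {r} xs → Any (λ a → include a ≡ true × r ℚ.≤ value a) xs → r ℚ.≤ maxOver xs
    ≤-maxOver (a ∷ xs) (here (included , r≤value)) rewrite included = ℚ.≤-trans r≤value (p≤p⊔q (value a) (maxOver xs))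
    ≤-maxOver (a ∷ xs) (there p) with include a
    ... | true  = ℚ.≤-trans (≤-maxOver xs p) (p≤q⊔p (value a) (maxOver xs))
    ... | false = ≤-maxOver xs p

minQ≤qv : ∀ (G : Graph) f x → minQ G f ℚ.≤ qv G f x
minQ≤qv G f x = minOver≤ (qv G f) (allFin (n G)) (∈-allFin x)

≤-minQ : ∀ (G : Graph) f {r} → r ℚ.≤ ℚ.1ℚ → (∀ x → r ℚ.≤ qv G f x) → r ℚ.≤ minQ G f
≤-minQ G f = ≤-minOver (qv G f) (allFin (n G))

q≤ : ∀ (G : Graph) {r} → ℚ.0ℚ ℚ.≤ r → (∀ f → isPartition f ≡ true → minQ G f ℚ.≤ r) → q G ℚ.≤ r
q≤ G = maxOver≤ (minQ G) isPartition (allSides (n G))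

≤-q : ∀ (G : Graph) f {r} → isPartition f ≡ true → r ℚ.≤ minQ G f → r ℚ.≤ q G
≤-q G f {r} partition r≤minQ = ≤-maxOver (minQ G) isPartition (allSides (n G))
  (Any.map (λ {g} g≗f → trans (isPartition-cong g≗f) partition ,
                        subst (r ℚ.≤_) (≡.sym (minQ-cong G g≗f)) r≤minQ)
           (allSides-complete (n G) f))

∃-opposite : ∀ {n} (f : Side n) → isPartition f ≡ true → ∀ x → ∃ λ u → f u ≡ not (f x)
∃-opposite {n} f partition x with to T-∧ (from T-≡ partition) | f x
... | _ , some-false | true  = let u , fu = satisfied (any⁻ _ (allFin n) some-false) in u , to T-not-≡ fu
... | some-true , _  | false = let u , fu = satisfied (any⁻ _ (allFin n) some-true)  in u , to T-≡ fu

pattern s   = zero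
pattern t   = Fin.suc zero
pattern v i = Fin.suc (Fin.suc i)

deg-s : ∀ k → deg (T k) s ≡ suc k
deg-s k = trans (countᶠ≡count (Tadj k s)) (cong suc (count-true k))

deg-t : ∀ k → deg (T k) t ≡ suc k
deg-t k = trans (countᶠ≡count (Tadj k t)) (cong suc (count-true k))

deg-v : ∀ k i → deg (T k) (v i) ≡ 2
deg-v k i = trans (countᶠ≡count (Tadj k (v i))) (cong (_+_ 2) (count-false k))

module _ {k : ℕ} (f : Side (suc (suc k))) where

  onSide : Bool → ℕ
  onSide b = count (λ i → f (v i) ==ᵇ b)

  onSide-+-onSide-not : ∀ b → onSide b + onSide (not b) ≡ k
  onSide-+-onSide-not b = trans (cong (_+_ (onSide b)) (count-cong (λ i → ==ᵇ-not (f (v i)) b)))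
                                (count-+-count-not (λ i → f (v i) ==ᵇ b))

  qv-s : f t ≡ not (f s) → qv (T k) f s ≡ + suc (onSide (f s)) /ℚ suc (suc k)
  qv-s separated = cong₂ (λ a d → + a /ℚ suc d) numerator (deg-s k)
    where
    numerator : countᶠ (λ u → inN[ T k ] s u ∧ (f u ==ᵇ f s)) ≡ suc (onSide (f s))
    numerator rewrite countᶠ≡count (λ u → inN[ T k ] s u ∧ (f u ==ᵇ f s))
                    | ==ᵇ-refl (f s) | separated | not-self-==ᵇ (f s) = refl

  qv-t : f t ≡ not (f s) → qv (T k) f t ≡ + suc (onSide (f t)) /ℚ suc (suc k)
  qv-t separated = cong₂ (λ a d → + a /ℚ suc d) numerator (deg-t k)
    where
    numerator : countᶠ (λ u → inN[ T k ] t u ∧ (f u ==ᵇ f t)) ≡ suc (onSide (f t))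
    numerator rewrite countᶠ≡count (λ u → inN[ T k ] t u ∧ (f u ==ᵇ f t))
                    | separated | ==ᵇ-not-self (f s) | ==ᵇ-refl (not (f s)) = refl

  qv-v : ∀ i → qv (T k) f (v i) ≡ + (bit (f s ==ᵇ f (v i)) + (bit (f t ==ᵇ f (v i)) + 1)) /ℚ 3
  qv-v i = cong₂ (λ a d → + a /ℚ suc d) numerator (deg-v k i)
    where
    numerator : countᶠ (λ u → inN[ T k ] (v i) u ∧ (f u ==ᵇ f (v i)))
              ≡ bit (f s ==ᵇ f (v i)) + (bit (f t ==ᵇ f (v i)) + 1)
    numerator = trans (countᶠ≡count (λ u → inN[ T k ] (v i) u ∧ (f u ==ᵇ f (v i))))
      (cong (λ c → bit (f s ==ᵇ f (v i)) + (bit (f t ==ᵇ f (v i)) + c))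
        (trans (count-cong (λ j → cong (_∧ (f (v j) ==ᵇ f (v i))) (∨-identityʳ (does (j ≟ i)))))
               (count-≟ i (λ j → f (v j) ==ᵇ f (v i)) (==ᵇ-refl (f (v i))))))

qT : ℕ → ℚ
qT k = + suc (k / 2) /ℚ suc (suc k)

0≤qT : ∀ k → ℚ.0ℚ ℚ.≤ qT k
0≤qT k = fraction-≤ 0 (suc (k / 2)) 0 (suc k) z≤n

⅓≤qT : ∀ k → + 1 /ℚ 3 ℚ.≤ qT k
⅓≤qT k = fraction-≤ 1 (suc (k / 2)) 2 (suc k)
  (subst (_≤ suc (k / 2) * 3) (≡.sym (*-identityˡ (2 + k))) (2+n≤[1+half]*3 k))

qT≤⅔ : ∀ k → qT k ℚ.≤ + 2 /ℚ 3
qT≤⅔ k = fraction-≤ (suc (k / 2)) 2 (suc k) 2 ([1+half]*3≤2*[2+n] k)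

qT≤1 : ∀ k → qT k ℚ.≤ ℚ.1ℚ
qT≤1 k = ℚ.≤-trans (qT≤⅔ k) (fraction-≤ 2 1 2 0 (s≤s (s≤s z≤n)))

module _ {k : ℕ} (f : Side (suc (suc k))) where
  open ℚ.≤-Reasoning

  smaller-side≤qT : ∀ {a b} → a + b ≡ k → a ≤ b → + suc a /ℚ suc (suc k) ℚ.≤ qT k
  smaller-side≤qT a+b≡k a≤b = fraction-mono (suc k) (s≤s (≤-half a+b≡k a≤b))

  module _ (separated : f t ≡ not (f s)) where

    separated-sides : onSide f (f s) + onSide f (f t) ≡ k
    separated-sides = trans (cong (_+_ (onSide f (f s)) ∘ onSide f) separated) (onSide-+-onSide-not f (f s))

    s-side≤qT : onSide f (f s) ≤ onSide f (f t) → minQ (T k) f ℚ.≤ qT k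
    s-side≤qT a≤b = begin
      minQ (T k) f                          ≤⟨ minQ≤qv (T k) f s ⟩
      qv (T k) f s                          ≡⟨ qv-s f separated ⟩
      + suc (onSide f (f s)) /ℚ suc (suc k) ≤⟨ smaller-side≤qT separated-sides a≤b ⟩
      qT k                                  ∎

    t-side≤qT : onSide f (f t) ≤ onSide f (f s) → minQ (T k) f ℚ.≤ qT k
    t-side≤qT b≤a = begin
      minQ (T k) f                          ≤⟨ minQ≤qv (T k) f t ⟩
      qv (T k) f t                          ≡⟨ qv-t f separated ⟩
      + suc (onSide f (f t)) /ℚ suc (suc k) ≤⟨ smaller-side≤qT (trans (+-comm (onSide f (f t)) (onSide f (f s))) separated-sides) b≤a ⟩
      qT k                                  ∎

    separated≤qT : minQ (T k) f ℚ.≤ qT k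
    separated≤qT = [ s-side≤qT , t-side≤qT ]′ (≤-total (onSide f (f s)) (onSide f (f t)))

  module _ (together : f t ≡ f s) where

    opposite≤qT : ∀ u → f u ≡ not (f s) → minQ (T k) f ℚ.≤ qT k
    opposite≤qT s     fs≡not = ⊥-elim (not-¬ refl fs≡not)
    opposite≤qT t     ft≡not = ⊥-elim (not-¬ together ft≡not)
    opposite≤qT (v i) fv≡not = begin
      minQ (T k) f                                                  ≤⟨ minQ≤qv (T k) f (v i) ⟩
      qv (T k) f (v i)                                              ≡⟨ qv-v f i ⟩
      + (bit (f s ==ᵇ f (v i)) + (bit (f t ==ᵇ f (v i)) + 1)) /ℚ 3 ≡⟨ cong (λ a → + a /ℚ 3) alone ⟩
      + 1 /ℚ 3                                                      ≤⟨ ⅓≤qT k ⟩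
      qT k                                                          ∎
      where
      alone : bit (f s ==ᵇ f (v i)) + (bit (f t ==ᵇ f (v i)) + 1) ≡ 1
      alone rewrite fv≡not | together | ==ᵇ-not-self (f s) = refl

    together≤qT : isPartition f ≡ true → minQ (T k) f ℚ.≤ qT k
    together≤qT partition = let u , fu≡not = ∃-opposite f partition s in opposite≤qT u fu≡not

  minQ≤qT : isPartition f ≡ true → minQ (T k) f ℚ.≤ qT k
  minQ≤qT partition = [ (λ together → together≤qT together partition) , separated≤qT ∘ ¬-not ]′
                        (toSum (f t Bool.≟ f s))

halfSplit : ∀ k → Side (suc (suc k))
halfSplit k s     = true
halfSplit k t     = false
halfSplit k (v i) = toℕ i <ᵇ k / 2

module _ (k : ℕ) where
  open ℚ.≤-Reasoning

  halfSplit-true : onSide (halfSplit k) true ≡ k / 2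
  halfSplit-true = trans (count-cong {n = k} (λ i → ==ᵇ-true (toℕ i <ᵇ k / 2))) (count-<ᵇ {n = k} (m/n≤m k 2))

  half≤halfSplit-false : k / 2 ≤ onSide (halfSplit k) false
  half≤halfSplit-false = half-≤ {n = k} (subst (λ a → a + onSide (halfSplit k) false ≡ k) halfSplit-true
                                       (onSide-+-onSide-not (halfSplit k) true))

  qT≤qv-halfSplit : ∀ x → qT k ℚ.≤ qv (T k) (halfSplit k) x
  qT≤qv-halfSplit s = ℚ.≤-reflexive (≡.sym (trans (qv-s (halfSplit k) refl)
                                                  (cong (λ a → + suc a /ℚ suc (suc k)) halfSplit-true)))
  qT≤qv-halfSplit t = begin
    qT k                                               ≤⟨ fraction-mono (suc k) (s≤s half≤halfSplit-false) ⟩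
    + suc (onSide (halfSplit k) false) /ℚ suc (suc k) ≡⟨ ≡.sym (qv-t (halfSplit k) refl) ⟩
    qv (T k) (halfSplit k) t                           ∎
  qT≤qv-halfSplit (v i) = begin
    qT k                               ≤⟨ qT≤⅔ k ⟩
    + 2 /ℚ 3                           ≡⟨ cong (λ a → + a /ℚ 3) (≡.sym (bit-true==ᵇ+bit-false==ᵇ (toℕ i <ᵇ k / 2))) ⟩
    + (bit (true ==ᵇ halfSplit k (v i)) + (bit (false ==ᵇ halfSplit k (v i)) + 1)) /ℚ 3
                                       ≡⟨ ≡.sym (qv-v (halfSplit k) i) ⟩
    qv (T k) (halfSplit k) (v i)       ∎

  qT≤minQ-halfSplit : qT k ℚ.≤ minQ (T k) (halfSplit k)
  qT≤minQ-halfSplit = ≤-minQ (T k) (halfSplit k) (qT≤1 k) qT≤qv-halfSplit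

fact1 : (k : ℕ) → 1 ≤ k → q (T k) ≡ (+ (k / 2 + 1)) /ℚ suc (suc k)
fact1 k _ = begin
  q (T k)                            ≡⟨ ℚ.≤-antisym (q≤ (T k) (0≤qT k) minQ≤qT)
                                                    (≤-q (T k) (halfSplit k) refl (qT≤minQ-halfSplit k)) ⟩
  qT k                               ≡⟨ cong (λ a → + a /ℚ suc (suc k)) (+-comm 1 (k / 2)) ⟩
  + (k / 2 + 1) /ℚ suc (suc k)       ∎
  where open ≡.≡-Reasoning
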